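{- Let $m,n\geq1$ and $k$ an integer, and let $x,x'$ be vertices of $S_{m,n,k}$ (permutations of $(1,\dots,m+n)$ with $x_1+\dots+x_m=k$). Then $x$ and $x'$ are joined by an edge of $S_{m,n,k}$ if $x'$ is obtained from $x$ in one of the following ways: (1) for some value $t$, the positions of the values $t$ and $t+1$ in $x$ are either both in $[m]$ or both in $\{m+1,\dots,m+n\}$, and $x'$ is obtained by swapping the values $t$ and $t+1$ (equivalently, swapping the labels of two consecutive steps of $L(x)$ with the same direction); (2) for some values $t,s$ with $|t-s|\geq 2$, the values $t+1$ and $s$ occur in $x$ at positions in $[m]$ and the values $t$ and $s+1$ occur at positions in $\{m+1,\dots,m+n\}$, and $x'$ is obtained by swapping the values $t\leftrightarrow t+1$ and $s\leftrightarrow s+1$ (equivalently, in $L(x)$, for an inner and an outer corner not sharing a step, deleting a box at one corner and adding a box at the other while keeping labels); (3) for some value $t$, either the values $t,t+2$ occur in $x$ at positions in $[m]$ and $t+1$ at a position in $\{m+1,\dots,m+n\}$, or $t,t+2$ occur at positions in $\{m+1,\dots,m+n\}$ and $t+1$ at a position in $[m]$; and $x'$ is obtained by swapping the values $t$ and $t+2$ (equivalently, in $L(x)$, swapping the labels of the two same-direction steps in a pattern $\uparrow\rightarrow\uparrow$ or $\rightarrow\uparrow\rightarrow$).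
   Context: $\Pi_N$ is the permutahedron, the convex hull of all permutations of the vector $(1,2,\dots,N)$. For positive integers $m,n$ and an integer $k$, $S_{m,n,k}=\{x\in\Pi_{m+n}: x_1+\dots+x_m=k\}$; its vertices are exactly the permutation vectors $x$ of $(1,\dots,m+n)$ with $x_1+\dots+x_m=k$. To such a vertex $x$ associate the labeled lattice path $L(x)$ from $(0,0)$ to $(n,m)$ with $m+n$ unit steps: for $t=1,\dots,m+n$, step $t$ is vertical with label $i$ if $x_i=t$ with $i\leq m$, and horizontal with label $j$ if $x_j=t$ with $j>m$. -}

module Defs where

open import Data.Nat using (ℕ; zero; suc; _+_; _≤_; _<_; _<?_; _≟_)
open import Data.Integer using (ℤ; +_; _*_; _≤_) renaming (_+_ to _+ℤ_)
open import Data.Fin using (Fin; toℕ)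
import Data.Fin as F
open import Data.Product using (Σ; ∃; _×_; _,_)
open import Data.Sum using (_⊎_)
open import Relation.Nullary using (¬_; does)
open import Relation.Binary.PropositionalEquality using (_≡_; _≢_)
open import Function.Definitions using (Injective)
open import Data.Bool using (if_then_else_)

sumF : (N : ℕ) → (Fin N → ℤ) → ℤ
sumF zero f = + 0
sumF (suc N) f = f F.zero +ℤ sumF N (λ i → f (F.suc i))

-- x : Fin N → ℕ is a permutation of the vector (1,...,N)
-- (coordinates indexed by Fin N; position i ∈ Fin N is the paper's index i+1)
IsPermVec : (N : ℕ) → (Fin N → ℕ) → Set
IsPermVec N x = (∀ i → 1 Data.Nat.≤ x i × x i Data.Nat.≤ N) × Injective _≡_ _≡_ x

InM : {N : ℕ} → ℕ → Fin N → Set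
InM m i = toℕ i < m

firstSum : (m n : ℕ) → (Fin (m + n) → ℕ) → ℤ
firstSum m n x = sumF (m + n) (λ i → if does (toℕ i <? m) then + x i else + 0)

IsVertex : (m n : ℕ) → ℤ → (Fin (m + n) → ℕ) → Set
IsVertex m n k x = IsPermVec (m + n) x × firstSum m n x ≡ k

dot : (N : ℕ) → (Fin N → ℤ) → (Fin N → ℕ) → ℤ
dot N c x = sumF N (λ i → c i * + x i)

-- x and x' (distinct vertices) span an edge of S_{m,n,k}: some linear functional c
-- attains its maximum over S_{m,n,k} exactly at the vertices x and x'
-- (the face exposed by c has vertex set {x, x'}).
IsEdge : (m n : ℕ) → ℤ → (Fin (m + n) → ℕ) → (Fin (m + n) → ℕ) → Set
IsEdge m n k x x' =
  ¬ (∀ i → x i ≡ x' i) ×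
  Σ (Fin (m + n) → ℤ) λ c →
    dot (m + n) c x ≡ dot (m + n) c x' ×
    (∀ y → IsVertex m n k y → dot (m + n) c y Data.Integer.≤ dot (m + n) c x) ×
    (∀ y → IsVertex m n k y → dot (m + n) c y ≡ dot (m + n) c x →
       (∀ i → y i ≡ x i) ⊎ (∀ i → y i ≡ x' i))

swapVal : ℕ → ℕ → ℕ → ℕ
swapVal a b v = if does (v ≟ a) then b else (if does (v ≟ b) then a else v)

Move1 : (m n : ℕ) → (Fin (m + n) → ℕ) → (Fin (m + n) → ℕ) → Set
Move1 m n x x' = ∃ λ t → ∃ λ i → ∃ λ j →
  x i ≡ t × x j ≡ suc t ×
  ((InM m i × InM m j) ⊎ (¬ InM m i × ¬ InM m j)) ×
  (∀ p → x' p ≡ swapVal t (suc t) (x p))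

Move2 : (m n : ℕ) → (Fin (m + n) → ℕ) → (Fin (m + n) → ℕ) → Set
Move2 m n x x' = ∃ λ t → ∃ λ s → ∃ λ a → ∃ λ b → ∃ λ i → ∃ λ j →
  (t + 2 Data.Nat.≤ s ⊎ s + 2 Data.Nat.≤ t) ×
  x a ≡ suc t × InM m a × x b ≡ s × InM m b ×
  x i ≡ t × ¬ InM m i × x j ≡ suc s × ¬ InM m j ×
  (∀ p → x' p ≡ swapVal t (suc t) (swapVal s (suc s) (x p)))

Move3 : (m n : ℕ) → (Fin (m + n) → ℕ) → (Fin (m + n) → ℕ) → Set
Move3 m n x x' = ∃ λ t → ∃ λ i → ∃ λ j → ∃ λ l →
  x i ≡ t × x j ≡ t + 2 × x l ≡ suc t ×
  ((InM m i × InM m j × ¬ InM m l) ⊎ (¬ InM m i × ¬ InM m j × InM m l)) ×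
  (∀ p → x' p ≡ swapVal t (t + 2) (x p))

{-# OPTIONS --safe #-}
-- Each move is certified by the linear functional c_p = G (x_p), where the slope G is constant on one
-- or two blocks of consecutive values containing the moved values and G v = 2v off the blocks. The line
-- of slope G a through (a, H a) supports a potential H at the integers, so the Bregman gap
-- H b - H a - G a (b - a) is nonnegative; as every vertex y is a rearrangement of x, the potential terms
-- cancel and c·x - c·y is the sum of the gaps (x_p, y_p). Hence x maximises c over the permutahedron,
-- and the maximisers are the y with all gaps zero: they agree with x off the blocks and permute the
-- values inside each block. For move (1) these are x and x′ only; for moves (2) and (3) they span a
-- square, resp. a hexagon, and the hyperplane x_1 + ... + x_m = k leaves exactly x and x′.
module Submission where

open import Defs
open import Data.Nat using (ℕ; _≤_)
open import Data.Integer using (ℤ)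
open import Data.Fin using (Fin)
open import Data.Sum using (_⊎_)

import Data.Integer.Properties as ℤₚ
open import Algebra.Properties.CommutativeMonoid.Sum ℤₚ.+-0-commutativeMonoid
  using (sum; sum-cong-≗; sum-replicate-zero; ∑-distrib-+; sum-remove)
open import Algebra.Properties.AbelianGroup ℤₚ.+-0-abelianGroup using (∙-cancelʳ; ∙-cancelˡ)
open import Data.Bool using (true; false; if_then_else_)
open import Data.Empty using (⊥-elim)
open import Data.List using (List; []; _∷_)
open import Data.List.Membership.Propositional using (_∈_; _∉_)
import Data.List.Relation.Unary.All as All
open All using (All; []; _∷_)
import Data.List.Relation.Unary.Any as Any
open Any using (here; there)
open import Data.Fin using (zero; suc; toℕ; punchIn; punchOut; fromℕ<)
import Data.Fin.Properties as Finₚ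
open import Data.Integer as ℤ using (+_; -[1+_]; _+_; _-_; _*_; 0ℤ)
open import Data.Integer.Tactic.RingSolver using (solve-∀)
import Data.Nat as ℕ
open import Data.Nat using (z≤n; s≤s; _<_; _<?_)
import Data.Nat.Properties as ℕₚ
open import Data.Product using (∃; _×_; _,_; proj₁; proj₂)
open import Data.Sum as Sum using (inj₁; inj₂)
open import Data.Vec.Functional using (removeAt)
open import Function using (_∘_; case_of_)
open import Function.Definitions using (Injective)
open import Relation.Binary.PropositionalEquality
  using (_≡_; _≢_; refl; sym; trans; cong; cong₂; subst; module ≡-Reasoning)
open import Relation.Nullary using (¬_; Dec; yes; no; does; contradiction)
open import Relation.Nullary.Decidable using (dec-true; dec-false; _⊎-dec_)

sumF≡sum : ∀ N (f : Fin N → ℤ) → sumF N f ≡ sum f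
sumF≡sum ℕ.zero    f = refl
sumF≡sum (ℕ.suc N) f = cong (_+_ (f zero)) (sumF≡sum N (f ∘ suc))

sum-nonneg : ∀ {N} {f : Fin N → ℤ} → (∀ i → 0ℤ ℤ.≤ f i) → 0ℤ ℤ.≤ sum f
sum-nonneg {ℕ.zero}  f≥0 = ℤₚ.≤-refl
sum-nonneg {ℕ.suc N} f≥0 = ℤₚ.+-mono-≤ (f≥0 zero) (sum-nonneg (f≥0 ∘ suc))

i≤i+nonneg : ∀ i {j} → 0ℤ ℤ.≤ j → i ℤ.≤ i + j
i≤i+nonneg i j≥0 = subst (ℤ._≤ i + _) (ℤₚ.+-identityʳ i) (ℤₚ.+-monoʳ-≤ i j≥0)

nonneg+nonneg≡0 : ∀ {i j} → 0ℤ ℤ.≤ i → 0ℤ ℤ.≤ j → i + j ≡ 0ℤ → i ≡ 0ℤ × j ≡ 0ℤ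
nonneg+nonneg≡0 {i} {j} i≥0 j≥0 i+j≡0 =
  ℤₚ.≤-antisym (subst (i ℤ.≤_) i+j≡0 (i≤i+nonneg i j≥0)) i≥0 ,
  ℤₚ.≤-antisym (subst (j ℤ.≤_) (trans (ℤₚ.+-comm j i) i+j≡0) (i≤i+nonneg j i≥0)) j≥0

sum-nonneg≡0 : ∀ {N} {f : Fin N → ℤ} → (∀ i → 0ℤ ℤ.≤ f i) → sum f ≡ 0ℤ → ∀ i → f i ≡ 0ℤ
sum-nonneg≡0 {ℕ.suc N} f≥0 Σ≡0 zero    = proj₁ (nonneg+nonneg≡0 (f≥0 zero) (sum-nonneg (f≥0 ∘ suc)) Σ≡0)
sum-nonneg≡0 {ℕ.suc N} f≥0 Σ≡0 (suc i) =
  sum-nonneg≡0 (f≥0 ∘ suc) (proj₂ (nonneg+nonneg≡0 (f≥0 zero) (sum-nonneg (f≥0 ∘ suc)) Σ≡0)) i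

sum-cong-except : ∀ {N} {f g : Fin N → ℤ} a → (∀ p → p ≢ a → f p ≡ g p) → sum f + g a ≡ sum g + f a
sum-cong-except {ℕ.suc N} {f} {g} a f≡g = begin
  sum f + g a                       ≡⟨ cong (_+ g a) (sum-remove {i = a} f) ⟩
  (f a + sum (removeAt f a)) + g a  ≡⟨ cong (λ r → (f a + r) + g a) (sum-cong-≗ agree-off-a) ⟩
  (f a + sum (removeAt g a)) + g a  ≡⟨ swap-outer (f a) _ (g a) ⟩
  (g a + sum (removeAt g a)) + f a  ≡⟨ cong (_+ f a) (sum-remove {i = a} g) ⟨
  sum g + f a                       ∎
  where
  open ≡-Reasoning
  agree-off-a : ∀ p → f (punchIn a p) ≡ g (punchIn a p)
  agree-off-a p = f≡g (punchIn a p) (Finₚ.punchInᵢ≢i a p)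
  swap-outer : ∀ u v w → (u + v) + w ≡ (w + v) + u
  swap-outer = solve-∀

sum-cong-except₂ : ∀ {N} {f g : Fin N → ℤ} {a b} → a ≢ b → (∀ p → p ≢ a → p ≢ b → f p ≡ g p) →
                   sum f + (g a + g b) ≡ sum g + (f a + f b)
sum-cong-except₂ {ℕ.suc N} {f} {g} {a} {b} a≢b f≡g = begin
  sum f + (g a + g b)                       ≡⟨ cong (_+ (g a + g b)) (sum-remove {i = a} f) ⟩
  (f a + sum (removeAt f a)) + (g a + g b)  ≡⟨ regroup (f a) _ (g a) (g b) ⟩
  (f a + g a) + (sum (removeAt f a) + g b)  ≡⟨ cong (_+_ (f a + g a)) removed ⟩
  (f a + g a) + (sum (removeAt g a) + f b)  ≡⟨ regroup′ (f a) (g a) _ (f b) ⟩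
  (g a + sum (removeAt g a)) + (f a + f b)  ≡⟨ cong (_+ (f a + f b)) (sum-remove {i = a} g) ⟨
  sum g + (f a + f b)                       ∎
  where
  open ≡-Reasoning
  regroup : ∀ u v w z → (u + v) + (w + z) ≡ (u + w) + (v + z)
  regroup = solve-∀
  regroup′ : ∀ u v w z → (u + v) + (w + z) ≡ (v + w) + (u + z)
  regroup′ = solve-∀
  punchIn-a-b : punchIn a (punchOut a≢b) ≡ b
  punchIn-a-b = Finₚ.punchIn-punchOut a≢b
  removed : sum (removeAt f a) + g b ≡ sum (removeAt g a) + f b
  removed = subst (λ q → sum (removeAt f a) + g q ≡ sum (removeAt g a) + f q) punchIn-a-b
    (sum-cong-except (punchOut a≢b) λ p p≢b′ → f≡g (punchIn a p) (Finₚ.punchInᵢ≢i a p)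
      (p≢b′ ∘ Finₚ.punchIn-injective a p _ ∘ (λ e → trans e (sym punchIn-a-b))))

opaque
  firstSummand : ∀ {N} → ℕ → (Fin N → ℕ) → Fin N → ℤ
  firstSummand m x i = if does (toℕ i <? m) then + x i else + 0

  firstSum≡sum : ∀ m n x → firstSum m n x ≡ sum (firstSummand m x)
  firstSum≡sum m n x = sumF≡sum (m ℕ.+ n) (firstSummand m x)

  firstSummand-inM : ∀ {N} {m} {x : Fin N → ℕ} {p} → InM m p → firstSummand m x p ≡ + x p
  firstSummand-inM {m = m} {p = p} p∈M rewrite dec-true (toℕ p <? m) p∈M = refl

  firstSummand-cong : ∀ {N} {m} {x y : Fin N → ℕ} {p} → (InM m p → y p ≡ x p) →
                      firstSummand m y p ≡ firstSummand m x p
  firstSummand-cong {m = m} {p = p} agree with toℕ p <? m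
  ... | yes p∈M rewrite dec-true (toℕ p <? m) p∈M = cong +_ (agree p∈M)
  ... | no p∉M  rewrite dec-false (toℕ p <? m) p∉M = refl

sum-firstSummand≡ : ∀ {m n} {x y : Fin (m ℕ.+ n) → ℕ} → firstSum m n y ≡ firstSum m n x →
                    sum (firstSummand m y) ≡ sum (firstSummand m x)
sum-firstSummand≡ {m} {n} {x} {y} Σ≡ = trans (sym (firstSum≡sum m n y)) (trans Σ≡ (firstSum≡sum m n x))

cancel-equal-sums : ∀ {s s′ u v : ℤ} → s ≡ s′ → s + u ≡ s′ + v → u ≡ v
cancel-equal-sums {s} refl = ∙-cancelˡ s _ _

firstSum-except : ∀ {m n} {x y : Fin (m ℕ.+ n) → ℕ} {a} → firstSum m n y ≡ firstSum m n x → InM m a →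
                  (∀ p → p ≢ a → InM m p → y p ≡ x p) → y a ≡ x a
firstSum-except {m} {n} {x} {y} {a} Σ≡ a∈M agree = ℤₚ.+-injective (begin
  + y a               ≡⟨ firstSummand-inM a∈M ⟨
  firstSummand m y a  ≡⟨ cancel-equal-sums (sum-firstSummand≡ {m} {n} {x} {y} Σ≡) agree-except-a ⟨
  firstSummand m x a  ≡⟨ firstSummand-inM a∈M ⟩
  + x a               ∎)
  where
  open ≡-Reasoning
  agree-except-a : sum (firstSummand m y) + firstSummand m x a ≡ sum (firstSummand m x) + firstSummand m y a
  agree-except-a = sum-cong-except a λ p p≢a → firstSummand-cong (agree p p≢a)

firstSum-except₂ : ∀ {m n} {x y : Fin (m ℕ.+ n) → ℕ} {a b} → firstSum m n y ≡ firstSum m n x →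
                   a ≢ b → InM m a → InM m b →
                   (∀ p → p ≢ a → p ≢ b → InM m p → y p ≡ x p) → y a ℕ.+ y b ≡ x a ℕ.+ x b
firstSum-except₂ {m} {n} {x} {y} {a} {b} Σ≡ a≢b a∈M b∈M agree = ℤₚ.+-injective (begin
  + (y a ℕ.+ y b)                          ≡⟨ ℤₚ.pos-+ (y a) (y b) ⟩
  + y a + + y b                            ≡⟨ cong₂ _+_ (firstSummand-inM a∈M) (firstSummand-inM b∈M) ⟨
  firstSummand m y a + firstSummand m y b  ≡⟨ cancel-equal-sums (sum-firstSummand≡ {m} {n} {x} {y} Σ≡)
                                                                agree-except-ab ⟨
  firstSummand m x a + firstSummand m x b  ≡⟨ cong₂ _+_ (firstSummand-inM a∈M) (firstSummand-inM b∈M) ⟩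
  + x a + + x b                            ≡⟨ ℤₚ.pos-+ (x a) (x b) ⟨
  + (x a ℕ.+ x b)                          ∎)
  where
  open ≡-Reasoning
  agree-except-ab : sum (firstSummand m y) + (firstSummand m x a + firstSummand m x b)
                    ≡ sum (firstSummand m x) + (firstSummand m y a + firstSummand m y b)
  agree-except-ab = sum-cong-except₂ a≢b λ p p≢a p≢b → firstSummand-cong (agree p p≢a p≢b)

pred-injective : ∀ {u v} → 1 ≤ u → 1 ≤ v → ℕ.pred u ≡ ℕ.pred v → u ≡ v
pred-injective (s≤s _) (s≤s _) = cong ℕ.suc

pred-mono-< : ∀ {u N} → 1 ≤ u → u < ℕ.suc N → ℕ.pred u < N
pred-mono-< (s≤s _) (s≤s u<N) = u<N

permVec-attains-max : ∀ {N} {x : Fin (ℕ.suc N) → ℕ} → IsPermVec (ℕ.suc N) x → ∃ λ q → x q ≡ ℕ.suc N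
permVec-attains-max {N} {x} (bounds , x-inj) with Finₚ.any? (λ q → x q ℕ.≟ ℕ.suc N)
... | yes attained = attained
... | no missed    = ⊥-elim (Finₚ.<⇒notInjective ℕₚ.≤-refl lower-injective)
  where
  pred<N : ∀ q → ℕ.pred (x q) < N
  pred<N q = pred-mono-< (proj₁ (bounds q)) (ℕₚ.≤∧≢⇒< (proj₂ (bounds q)) (missed ∘ (q ,_)))
  lower : Fin (ℕ.suc N) → Fin N
  lower q = fromℕ< (pred<N q)
  lower-injective : Injective _≡_ _≡_ lower
  lower-injective {p} {q} e = x-inj (pred-injective (proj₁ (bounds p)) (proj₁ (bounds q))
    (trans (sym (Finₚ.toℕ-fromℕ< (pred<N p))) (trans (cong toℕ e) (Finₚ.toℕ-fromℕ< (pred<N q)))))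

permVec-removeAt : ∀ {N} {x : Fin (ℕ.suc N) → ℕ} {q} → IsPermVec (ℕ.suc N) x → x q ≡ ℕ.suc N →
                   IsPermVec N (removeAt x q)
permVec-removeAt {N} {x} {q} (bounds , x-inj) xq≡max = bounds′ , Finₚ.punchIn-injective q _ _ ∘ x-inj
  where
  bounds′ : ∀ p → 1 ≤ x (punchIn q p) × x (punchIn q p) ≤ N
  bounds′ p = proj₁ (bounds (punchIn q p)) , ℕₚ.m<1+n⇒m≤n (ℕₚ.≤∧≢⇒< (proj₂ (bounds (punchIn q p)))
    (Finₚ.punchInᵢ≢i q p ∘ x-inj ∘ (λ e → trans e (sym xq≡max))))

sum-permVec : ∀ {N} {x y : Fin N → ℕ} → IsPermVec N x → IsPermVec N y → (h : ℕ → ℤ) → sum (h ∘ x) ≡ sum (h ∘ y)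
sum-permVec {ℕ.zero}  _  _  h = refl
sum-permVec {ℕ.suc N} {x} {y} px py h with permVec-attains-max px | permVec-attains-max py
... | q , xq≡max | r , yr≡max = begin
  sum (h ∘ x)                          ≡⟨ sum-remove {i = q} (h ∘ x) ⟩
  h (x q) + sum (h ∘ removeAt x q)     ≡⟨ cong₂ _+_ (cong h (trans xq≡max (sym yr≡max)))
                                            (sum-permVec (permVec-removeAt px xq≡max) (permVec-removeAt py yr≡max) h) ⟩
  h (y r) + sum (h ∘ removeAt y r)     ≡⟨ sum-remove {i = r} (h ∘ y) ⟨
  sum (h ∘ y)                          ∎
  where open ≡-Reasoning

-- Gaps and the edge criterion

square : ℕ → ℤ
square v = + v * + v

opaque
  -- The Bregman divergence of H at a, with G a in the role of the derivative H′ a.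
  gap : (slope potential : ℕ → ℤ) → ℕ → ℕ → ℤ
  gap G H a b = H b - H a - G a * (+ b - + a)

  gap-refl : ∀ G H a → gap G H a a ≡ 0ℤ
  gap-refl G H a = vanish (H a) (G a) (+ a)
    where
    vanish : ∀ h g u → h - h - g * (u - u) ≡ 0ℤ
    vanish = solve-∀

  -- The potential terms cancel because y is a rearrangement of x.
  dot+gaps : ∀ {N} {x y : Fin N → ℕ} (G H : ℕ → ℤ) → IsPermVec N x → IsPermVec N y →
             dot N (G ∘ x) y + sum (λ p → gap G H (x p) (y p)) ≡ dot N (G ∘ x) x
  dot+gaps {N} {x} {y} G H px py = ∙-cancelʳ (sum (H ∘ x)) _ _ (begin
    (dot N c y + sum gaps) + sum (H ∘ x)      ≡⟨ cong (λ d → (d + sum gaps) + sum (H ∘ x)) (sumF≡sum N cy) ⟩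
    (sum cy + sum gaps) + sum (H ∘ x)        ≡⟨ cong (_+ sum (H ∘ x)) (∑-distrib-+ cy gaps) ⟨
    sum (λ p → cy p + gaps p) + sum (H ∘ x)  ≡⟨ ∑-distrib-+ _ (H ∘ x) ⟨
    sum (λ p → (cy p + gaps p) + H (x p))    ≡⟨ sum-cong-≗ (λ p → tangent (c p) (+ x p) (+ y p) (H (x p)) (H (y p))) ⟩
    sum (λ p → cx p + H (y p))               ≡⟨ ∑-distrib-+ cx (H ∘ y) ⟩
    sum cx + sum (H ∘ y)                     ≡⟨ cong₂ _+_ (sumF≡sum N cx) (sum-permVec px py H) ⟨
    dot N c x + sum (H ∘ x)                  ∎)
    where
    open ≡-Reasoning
    c cx cy gaps : Fin N → ℤ
    c = G ∘ x
    cx p = c p * + x p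
    cy p = c p * + y p
    gaps p = gap G H (x p) (y p)
    tangent : ∀ g a b ha hb → (g * b + (hb - ha - g * (b - a))) + ha ≡ g * a + hb
    tangent = solve-∀

  -- a + a′ is the slope of the chord of v ↦ v² between a and a′.
  gap-square : ∀ G a a′ b → G a ≡ + a + + a′ → gap G square a b ≡ (+ b - + a) * (+ b - + a′)
  gap-square G a a′ b Ga≡a+a′ rewrite Ga≡a+a′ = chord (+ a) (+ a′) (+ b)
    where
    chord : ∀ a a′ b → b * b - a * a - (a + a′) * (b - a) ≡ (b - a) * (b - a′)
    chord = solve-∀

  gap-+potential : ∀ (G H K : ℕ → ℤ) a b → gap G (λ v → H v + K v) a b ≡ gap G H a b + (K b - K a)
  gap-+potential G H K a b = split (H a) (H b) (K a) (K b) (G a * (+ b - + a))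
    where
    split : ∀ ha hb ka kb s → (hb + kb) - (ha + ka) - s ≡ (hb - ha - s) + (kb - ka)
    split = solve-∀

  gap-slope-cong : ∀ {G G′} H {a} b → G a ≡ G′ a → gap G H a b ≡ gap G′ H a b
  gap-slope-cong H b Ga≡G′a rewrite Ga≡G′a = refl

ZeroGap : ∀ {N} (G H : ℕ → ℤ) → (x y : Fin N → ℕ) → Set
ZeroGap G H x y = ∀ p → gap G H (x p) (y p) ≡ 0ℤ

module _ {N} {x y : Fin N → ℕ} (G H : ℕ → ℤ) (px : IsPermVec N x) (py : IsPermVec N y) where

  dot-≤ : (∀ a b → 0ℤ ℤ.≤ gap G H a b) → dot N (G ∘ x) y ℤ.≤ dot N (G ∘ x) x
  dot-≤ gap≥0 = subst (dot N (G ∘ x) y ℤ.≤_) (dot+gaps G H px py)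
                  (i≤i+nonneg _ (sum-nonneg λ p → gap≥0 (x p) (y p)))

  dot-≡⇒zeroGap : (∀ a b → 0ℤ ℤ.≤ gap G H a b) → dot N (G ∘ x) y ≡ dot N (G ∘ x) x → ZeroGap G H x y
  dot-≡⇒zeroGap gap≥0 y-max = sum-nonneg≡0 (λ p → gap≥0 (x p) (y p))
    (∙-cancelˡ (dot N (G ∘ x) y) _ _ (trans (dot+gaps G H px py) (trans (sym y-max) (sym (ℤₚ.+-identityʳ _)))))

  zeroGap⇒dot-≡ : ZeroGap G H x y → dot N (G ∘ x) y ≡ dot N (G ∘ x) x
  zeroGap⇒dot-≡ zero-gap = begin
    dot N (G ∘ x) y                          ≡⟨ ℤₚ.+-identityʳ _ ⟨
    dot N (G ∘ x) y + 0ℤ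
      ≡⟨ cong (_+_ (dot N (G ∘ x) y)) (trans (sum-cong-≗ zero-gap) (sum-replicate-zero N)) ⟨
    dot N (G ∘ x) y + sum (λ p → gap G H (x p) (y p))
      ≡⟨ dot+gaps G H px py ⟩
    dot N (G ∘ x) x                          ∎
    where open ≡-Reasoning

isEdge-byGap : ∀ {m n k} {x x′ : Fin (m ℕ.+ n) → ℕ} (G H : ℕ → ℤ) →
               IsVertex m n k x → IsVertex m n k x′ → ¬ (∀ p → x p ≡ x′ p) →
               (∀ a b → 0ℤ ℤ.≤ gap G H a b) → ZeroGap G H x x′ →
               (∀ y → IsVertex m n k y → ZeroGap G H x y → (∀ p → y p ≡ x p) ⊎ (∀ p → y p ≡ x′ p)) →
               IsEdge m n k x x′
isEdge-byGap {x = x} G H (px , _) (px′ , _) x≢x′ gap≥0 zero-gap-x′ zero-gap⇒ =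
  x≢x′ , G ∘ x , sym (zeroGap⇒dot-≡ G H px px′ zero-gap-x′) ,
  (λ y (py , _) → dot-≤ G H px py gap≥0) ,
  (λ y vy y-max → zero-gap⇒ y vy (dot-≡⇒zeroGap G H px (proj₁ vy) gap≥0 y-max))

zeroGap-relabel : ∀ {N} {G H : ℕ → ℤ} {x x′ : Fin N → ℕ} (σ : ℕ → ℕ) →
                  (∀ v → gap G H v (σ v) ≡ 0ℤ) → (∀ p → x′ p ≡ σ (x p)) → ZeroGap G H x x′
zeroGap-relabel {G = G} {H} {x} σ σ-tight x′≗ p = subst (λ w → gap G H (x p) w ≡ 0ℤ) (sym (x′≗ p)) (σ-tight (x p))

-- Block potentials

0≤pos*pos : ∀ a b → 0ℤ ℤ.≤ + a * + b
0≤pos*pos a b = subst (0ℤ ℤ.≤_) (ℤₚ.pos-* a b) (ℤ.+≤+ z≤n)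

i*i-nonneg : ∀ i → 0ℤ ℤ.≤ i * i
i*i-nonneg (+ n)    = 0≤pos*pos n n
i*i-nonneg -[1+ n ] = ℤ.+≤+ z≤n

i*[i-1]-nonneg : ∀ i → 0ℤ ℤ.≤ i * (i - + 1)
i*[i-1]-nonneg (+ 0)       = ℤ.+≤+ z≤n
i*[i-1]-nonneg (+ ℕ.suc n) = 0≤pos*pos (ℕ.suc n) n
i*[i-1]-nonneg -[1+ n ]    = ℤ.+≤+ z≤n

i*[i-2]-nonneg : ∀ i → i ≢ + 1 → 0ℤ ℤ.≤ i * (i - + 2)
i*[i-2]-nonneg (+ 0)             _   = ℤ.+≤+ z≤n
i*[i-2]-nonneg (+ 1)             i≢1 = contradiction refl i≢1
i*[i-2]-nonneg (+ ℕ.suc (ℕ.suc n)) _ = 0≤pos*pos (ℕ.suc (ℕ.suc n)) n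
i*[i-2]-nonneg -[1+ n ]          _   = ℤ.+≤+ z≤n

i*i≡0 : ∀ i → i * i ≡ 0ℤ → i ≡ 0ℤ
i*i≡0 i ii≡0 = Sum.reduce (ℤₚ.i*j≡0⇒i≡0∨j≡0 i ii≡0)

i*[i-d]≡0 : ∀ i d → i * (i - + d) ≡ 0ℤ → i ≡ 0ℤ ⊎ i ≡ + d
i*[i-d]≡0 i d e = Sum.map₂ (ℤₚ.i-j≡0⇒i≡j i (+ d)) (ℤₚ.i*j≡0⇒i≡0∨j≡0 i e)

+m-+n≡+d⇒m≡d+n : ∀ {m n d} → + m - + n ≡ + d → m ≡ d ℕ.+ n
+m-+n≡+d⇒m≡d+n {m} {n} e = ℤₚ.+-injective (trans (shift (+ m) (+ n)) (cong (_+ + n) e))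
  where
  shift : ∀ m n → m ≡ (m - n) + n
  shift = solve-∀

diagonal : ℕ → ℤ
diagonal v = + v + + v

gap-diagonal-nonneg : ∀ a b → 0ℤ ℤ.≤ gap diagonal square a b
gap-diagonal-nonneg a b rewrite gap-square diagonal a a b refl = i*i-nonneg (+ b - + a)

gap-diagonal≡0 : ∀ {a b} → gap diagonal square a b ≡ 0ℤ → b ≡ a
gap-diagonal≡0 {a} {b} gap≡0 = +m-+n≡+d⇒m≡d+n (i*i≡0 _ (trans (sym (gap-square diagonal a a b refl)) gap≡0))

Pair : ℕ → ℕ → Set
Pair t v = v ≡ t ⊎ v ≡ ℕ.suc t

pair? : ∀ t v → Dec (Pair t v)
pair? t v = v ℕ.≟ t ⊎-dec v ℕ.≟ ℕ.suc t

withPair : ℕ → (ℕ → ℤ) → ℕ → ℤ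
withPair t G v = if does (pair? t v) then + t + + ℕ.suc t else G v

module _ {t : ℕ} {G : ℕ → ℤ} where

  withPair-in : ∀ {v} → Pair t v → withPair t G v ≡ + t + + ℕ.suc t
  withPair-in {v} v∈t rewrite dec-true (pair? t v) v∈t = refl

  withPair-out : ∀ {v} → ¬ Pair t v → withPair t G v ≡ G v
  withPair-out {v} v∉t rewrite dec-false (pair? t v) v∉t = refl

  gap-withPair-out : ∀ H {a} b → ¬ Pair t a → gap (withPair t G) H a b ≡ gap G H a b
  gap-withPair-out H b a∉t = gap-slope-cong H b (withPair-out a∉t)

  gap-withPair-in : ∀ {a} b → Pair t a → gap (withPair t G) square a b ≡ (+ b - + t) * ((+ b - + t) - + 1)
  gap-withPair-in b a∈t@(inj₁ refl) =
    trans (gap-square (withPair t G) t (ℕ.suc t) b (withPair-in a∈t)) (shift (+ b) (+ t))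
    where
    shift : ∀ b t → (b - t) * (b - (+ 1 + t)) ≡ (b - t) * ((b - t) - + 1)
    shift = solve-∀
  gap-withPair-in b a∈t@(inj₂ refl) =
    trans (gap-square (withPair t G) (ℕ.suc t) t b (trans (withPair-in a∈t) (ℤₚ.+-comm (+ t) (+ ℕ.suc t))))
          (shift (+ b) (+ t))
    where
    shift : ∀ b t → (b - (+ 1 + t)) * (b - t) ≡ (b - t) * ((b - t) - + 1)
    shift = solve-∀

  gap-withPair-nonneg : (∀ a b → 0ℤ ℤ.≤ gap G square a b) → ∀ a b → 0ℤ ℤ.≤ gap (withPair t G) square a b
  gap-withPair-nonneg G-nonneg a b = case pair? t a of λ where
    (yes a∈t) → subst (0ℤ ℤ.≤_) (sym (gap-withPair-in b a∈t)) (i*[i-1]-nonneg (+ b - + t))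
    (no  a∉t) → subst (0ℤ ℤ.≤_) (sym (gap-withPair-out square b a∉t)) (G-nonneg a b)

  gap-withPair≡0-in : ∀ {a b} → Pair t a → gap (withPair t G) square a b ≡ 0ℤ → Pair t b
  gap-withPair≡0-in {b = b} a∈t gap≡0 =
    Sum.map +m-+n≡+d⇒m≡d+n +m-+n≡+d⇒m≡d+n (i*[i-d]≡0 (+ b - + t) 1 (trans (sym (gap-withPair-in b a∈t)) gap≡0))

  gap-withPair≡0-out : ∀ {a b} → ¬ Pair t a → gap (withPair t G) square a b ≡ 0ℤ → gap G square a b ≡ 0ℤ
  gap-withPair≡0-out {b = b} a∉t = trans (sym (gap-withPair-out square b a∉t))

  gap-withPair-within : ∀ {a b} → Pair t a → Pair t b → gap (withPair t G) square a b ≡ 0ℤ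
  gap-withPair-within {b = b} a∈t (inj₁ refl) = trans (gap-withPair-in b a∈t) (vanish (+ t))
    where
    vanish : ∀ t → (t - t) * ((t - t) - + 1) ≡ 0ℤ
    vanish = solve-∀
  gap-withPair-within {b = b} a∈t (inj₂ refl) = trans (gap-withPair-in b a∈t) (vanish (+ t))
    where
    vanish : ∀ t → ((+ 1 + t) - t) * (((+ 1 + t) - t) - + 1) ≡ 0ℤ
    vanish = solve-∀

t+2≢t+1 : ∀ {t} → t ℕ.+ 2 ≢ ℕ.suc t
t+2≢t+1 {t} e = ℕₚ.1+n≢n (trans (ℕₚ.+-comm 2 t) e)

t≢t+2 : ∀ {t} → t ≢ t ℕ.+ 2
t≢t+2 {t} = ℕₚ.<⇒≢ (ℕₚ.m<m+n t (s≤s z≤n))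

Triple : ℕ → ℕ → Set
Triple t v = v ≡ t ⊎ v ≡ ℕ.suc t ⊎ v ≡ t ℕ.+ 2

triple? : ∀ t v → Dec (Triple t v)
triple? t v = v ℕ.≟ t ⊎-dec v ℕ.≟ ℕ.suc t ⊎-dec v ℕ.≟ t ℕ.+ 2

tripleSlope : ℕ → ℕ → ℤ
tripleSlope t v = if does (triple? t v) then + t + + (t ℕ.+ 2) else diagonal v

-- At t + 1 the square lies 1 below its chord through t and t + 2; the bump lifts it onto the chord,
-- so that all three values of the block are ties for the slope t + (t + 2).
middleBump : ℕ → ℕ → ℤ
middleBump t v = if does (v ℕ.≟ ℕ.suc t) then + 1 else 0ℤ

triplePotential : ℕ → ℕ → ℤ
triplePotential t v = square v + middleBump t v

tripleBlockGap : ℕ → ℕ → ℤ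
tripleBlockGap t b = (+ b - + t) * ((+ b - + t) - + 2) + middleBump t b

module _ {t : ℕ} where

  middleBump-nonneg : ∀ v → 0ℤ ℤ.≤ middleBump t v
  middleBump-nonneg v with does (v ℕ.≟ ℕ.suc t)
  ... | true  = ℤ.+≤+ z≤n
  ... | false = ℤ.+≤+ z≤n

  middleBump-off : ∀ {v} → v ≢ ℕ.suc t → middleBump t v ≡ 0ℤ
  middleBump-off {v} v≢t+1 rewrite dec-false (v ℕ.≟ ℕ.suc t) v≢t+1 = refl

  middleBump-on : middleBump t (ℕ.suc t) ≡ + 1
  middleBump-on rewrite dec-true (ℕ.suc t ℕ.≟ ℕ.suc t) refl = refl

  tripleSlope-in : ∀ {v} → Triple t v → tripleSlope t v ≡ + t + + (t ℕ.+ 2)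
  tripleSlope-in {v} v∈t rewrite dec-true (triple? t v) v∈t = refl

  tripleSlope-out : ∀ {v} → ¬ Triple t v → tripleSlope t v ≡ diagonal v
  tripleSlope-out {v} v∉t rewrite dec-false (triple? t v) v∉t = refl

  tripleBlockGap-within : ∀ {b} → Triple t b → tripleBlockGap t b ≡ 0ℤ
  tripleBlockGap-within (inj₁ refl) rewrite middleBump-off (ℕₚ.1+n≢n ∘ sym) = vanish (+ t)
    where
    vanish : ∀ t → (t - t) * ((t - t) - + 2) + 0ℤ ≡ 0ℤ
    vanish = solve-∀
  tripleBlockGap-within (inj₂ (inj₁ refl)) rewrite middleBump-on = vanish (+ t)
    where
    vanish : ∀ t → ((+ 1 + t) - t) * (((+ 1 + t) - t) - + 2) + + 1 ≡ 0ℤ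
    vanish = solve-∀
  tripleBlockGap-within (inj₂ (inj₂ refl)) rewrite middleBump-off t+2≢t+1 = vanish (+ t)
    where
    vanish : ∀ t → ((t + + 2) - t) * (((t + + 2) - t) - + 2) + 0ℤ ≡ 0ℤ
    vanish = solve-∀

  tripleBlockGap-nonneg : ∀ b → 0ℤ ℤ.≤ tripleBlockGap t b
  tripleBlockGap-nonneg b with b ℕ.≟ ℕ.suc t
  ... | yes b≡t+1 = ℤₚ.≤-reflexive (sym (tripleBlockGap-within (inj₂ (inj₁ b≡t+1))))
  ... | no  b≢t+1 rewrite middleBump-off b≢t+1 | ℤₚ.+-identityʳ ((+ b - + t) * ((+ b - + t) - + 2)) =
    i*[i-2]-nonneg (+ b - + t) (b≢t+1 ∘ +m-+n≡+d⇒m≡d+n)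

  tripleBlockGap≡0 : ∀ {b} → tripleBlockGap t b ≡ 0ℤ → Triple t b
  tripleBlockGap≡0 {b} blockGap≡0 with b ℕ.≟ ℕ.suc t
  ... | yes b≡t+1 = inj₂ (inj₁ b≡t+1)
  ... | no  b≢t+1 rewrite middleBump-off b≢t+1 | ℤₚ.+-identityʳ ((+ b - + t) * ((+ b - + t) - + 2))
    with i*[i-d]≡0 (+ b - + t) 2 blockGap≡0
  ...   | inj₁ b-t≡0 = inj₁ (+m-+n≡+d⇒m≡d+n b-t≡0)
  ...   | inj₂ b-t≡2 = inj₂ (inj₂ (trans (+m-+n≡+d⇒m≡d+n b-t≡2) (ℕₚ.+-comm 2 t)))

  gap-triple-in : ∀ {a} b → Triple t a → gap (tripleSlope t) (triplePotential t) a b ≡ tripleBlockGap t b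
  gap-triple-in {a} b a∈t = trans (gap-+potential (tripleSlope t) square (middleBump t) a b) (chord a∈t)
    where
    centre : ∀ t → t + (t + + 2) ≡ (+ 1 + t) + (+ 1 + t)
    centre = solve-∀
    chord : Triple t a → gap (tripleSlope t) square a b + (middleBump t b - middleBump t a) ≡ tripleBlockGap t b
    chord (inj₁ refl) rewrite gap-square (tripleSlope t) t (t ℕ.+ 2) b (tripleSlope-in a∈t)
                            | middleBump-off (ℕₚ.1+n≢n ∘ sym) = low (+ b) (+ t) (middleBump t b)
      where
      low : ∀ b t k → (b - t) * (b - (t + + 2)) + (k - 0ℤ) ≡ (b - t) * ((b - t) - + 2) + k
      low = solve-∀
    chord (inj₂ (inj₁ refl)) rewrite gap-square (tripleSlope t) (ℕ.suc t) (ℕ.suc t) b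
                                       (trans (tripleSlope-in a∈t) (centre (+ t)))
                                   | middleBump-on = mid (+ b) (+ t) (middleBump t b)
      where
      mid : ∀ b t k → (b - (+ 1 + t)) * (b - (+ 1 + t)) + (k - + 1) ≡ (b - t) * ((b - t) - + 2) + k
      mid = solve-∀
    chord (inj₂ (inj₂ refl)) rewrite gap-square (tripleSlope t) (t ℕ.+ 2) t b
                                       (trans (tripleSlope-in a∈t) (ℤₚ.+-comm (+ t) (+ (t ℕ.+ 2))))
                                   | middleBump-off t+2≢t+1 = high (+ b) (+ t) (middleBump t b)
      where
      high : ∀ b t k → (b - (t + + 2)) * (b - t) + (k - 0ℤ) ≡ (b - t) * ((b - t) - + 2) + k
      high = solve-∀

  gap-triple-out : ∀ {a} b → ¬ Triple t a →
                   gap (tripleSlope t) (triplePotential t) a b ≡ (+ b - + a) * (+ b - + a) + middleBump t b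
  gap-triple-out {a} b a∉t rewrite gap-+potential (tripleSlope t) square (middleBump t) a b
                                 | gap-square (tripleSlope t) a a b (tripleSlope-out a∉t)
                                 | middleBump-off (a∉t ∘ inj₂ ∘ inj₁) =
    cong (_+_ ((+ b - + a) * (+ b - + a))) (ℤₚ.+-identityʳ (middleBump t b))

  gap-triple-nonneg : ∀ a b → 0ℤ ℤ.≤ gap (tripleSlope t) (triplePotential t) a b
  gap-triple-nonneg a b = case triple? t a of λ where
    (yes a∈t) → subst (0ℤ ℤ.≤_) (sym (gap-triple-in b a∈t)) (tripleBlockGap-nonneg b)
    (no  a∉t) → subst (0ℤ ℤ.≤_) (sym (gap-triple-out b a∉t))
                  (ℤₚ.+-mono-≤ (i*i-nonneg (+ b - + a)) (middleBump-nonneg b))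

  gap-triple≡0-in : ∀ {a b} → Triple t a → gap (tripleSlope t) (triplePotential t) a b ≡ 0ℤ → Triple t b
  gap-triple≡0-in {b = b} a∈t gap≡0 = tripleBlockGap≡0 (trans (sym (gap-triple-in b a∈t)) gap≡0)

  gap-triple≡0-out : ∀ {a b} → ¬ Triple t a → gap (tripleSlope t) (triplePotential t) a b ≡ 0ℤ → b ≡ a
  gap-triple≡0-out {a} {b} a∉t gap≡0 = +m-+n≡+d⇒m≡d+n (i*i≡0 _ (proj₁
    (nonneg+nonneg≡0 (i*i-nonneg (+ b - + a)) (middleBump-nonneg b) (trans (sym (gap-triple-out b a∉t)) gap≡0))))

  gap-triple-within : ∀ {a b} → Triple t a → Triple t b → gap (tripleSlope t) (triplePotential t) a b ≡ 0ℤ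
  gap-triple-within {b = b} a∈t b∈t = trans (gap-triple-in b a∈t) (tripleBlockGap-within b∈t)

swapVal-left : ∀ a b → swapVal a b a ≡ b
swapVal-left a b rewrite dec-true (a ℕ.≟ a) refl = refl

swapVal-right : ∀ a b → swapVal a b b ≡ a
swapVal-right a b with b ℕ.≟ a
... | yes b≡a rewrite dec-true (b ℕ.≟ a) b≡a = b≡a
... | no  b≢a rewrite dec-false (b ℕ.≟ a) b≢a | dec-true (b ℕ.≟ b) refl = refl

swapVal-other : ∀ {a b v} → v ≢ a → v ≢ b → swapVal a b v ≡ v
swapVal-other {a} {b} {v} v≢a v≢b rewrite dec-false (v ℕ.≟ a) v≢a | dec-false (v ℕ.≟ b) v≢b = refl

swapVal-pair : ∀ {t v} → Pair t v → Pair t (swapVal t (ℕ.suc t) v)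
swapVal-pair {t} (inj₁ refl) = inj₂ (swapVal-left t (ℕ.suc t))
swapVal-pair {t} (inj₂ refl) = inj₁ (swapVal-right t (ℕ.suc t))

swapVal-not-pair : ∀ {t v} → ¬ Pair t v → swapVal t (ℕ.suc t) v ≡ v
swapVal-not-pair v∉t = swapVal-other (v∉t ∘ inj₁) (v∉t ∘ inj₂)

-- The three moves

distinct-in-pair : ∀ {A : Set} {c d u v : A} → u ≡ c ⊎ u ≡ d → v ≡ c ⊎ v ≡ d → u ≢ v →
                   (u ≡ c × v ≡ d) ⊎ (u ≡ d × v ≡ c)
distinct-in-pair (inj₁ u≡c) (inj₁ v≡c) u≢v = contradiction (trans u≡c (sym v≡c)) u≢v
distinct-in-pair (inj₁ u≡c) (inj₂ v≡d) _   = inj₁ (u≡c , v≡d)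
distinct-in-pair (inj₂ u≡d) (inj₁ v≡c) _   = inj₂ (u≡d , v≡c)
distinct-in-pair (inj₂ u≡d) (inj₂ v≡d) u≢v = contradiction (trans u≡d (sym v≡d)) u≢v

agree-outside : ∀ {N} {x y z : Fin N → ℕ} (Q : List (Fin N)) →
                (∀ p → p ∉ Q → y p ≡ x p) → (∀ p → p ∉ Q → z p ≡ x p) →
                All (λ q → y q ≡ z q) Q → ∀ p → y p ≡ z p
agree-outside Q y-off z-off on p with Any.any? (p Finₚ.≟_) Q
... | yes p∈Q = All.lookup on p∈Q
... | no  p∉Q = trans (y-off p p∉Q) (sym (z-off p p∉Q))

injective⇒≢ : ∀ {N} {x y : Fin N → ℕ} → Injective _≡_ _≡_ y → ∀ {p q} → x p ≢ x q → y p ≢ y q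
injective⇒≢ {x = x} y-inj xp≢xq = xp≢xq ∘ cong x ∘ y-inj

module Move₁ {m n k} {x x′ : Fin (m ℕ.+ n) → ℕ} (vx : IsVertex m n k x) (vx′ : IsVertex m n k x′)
             {t i j} (xi≡t : x i ≡ t) (xj≡t+1 : x j ≡ ℕ.suc t) (x′≗ : ∀ p → x′ p ≡ swapVal t (ℕ.suc t) (x p)) where

  private
    σ : ℕ → ℕ
    σ = swapVal t (ℕ.suc t)

    G : ℕ → ℤ
    G = withPair t diagonal

    Q : List (Fin (m ℕ.+ n))
    Q = i ∷ j ∷ []

    pair⇒∈Q : ∀ p → Pair t (x p) → p ∈ Q
    pair⇒∈Q p (inj₁ xp≡t)   = here (proj₂ (proj₁ vx) (trans xp≡t (sym xi≡t)))
    pair⇒∈Q p (inj₂ xp≡t+1) = there (here (proj₂ (proj₁ vx) (trans xp≡t+1 (sym xj≡t+1))))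

    x′i≡t+1 : x′ i ≡ ℕ.suc t
    x′i≡t+1 rewrite x′≗ i | xi≡t = swapVal-left t (ℕ.suc t)

    x′j≡t : x′ j ≡ t
    x′j≡t rewrite x′≗ j | xj≡t+1 = swapVal-right t (ℕ.suc t)

    x′-off : ∀ p → p ∉ Q → x′ p ≡ x p
    x′-off p p∉Q = trans (x′≗ p) (swapVal-not-pair (p∉Q ∘ pair⇒∈Q p))

    xi≢xj : x i ≢ x j
    xi≢xj xi≡xj = ℕₚ.1+n≢n (trans (sym xj≡t+1) (trans (sym xi≡xj) xi≡t))

    x≢x′ : ¬ (∀ p → x p ≡ x′ p)
    x≢x′ x≗x′ = ℕₚ.1+n≢n (trans (sym x′i≡t+1) (trans (sym (x≗x′ i)) xi≡t))

    σ-tight : ∀ v → gap G square v (σ v) ≡ 0ℤ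
    σ-tight v = case pair? t v of λ where
      (yes v∈t) → gap-withPair-within v∈t (swapVal-pair v∈t)
      (no  v∉t) → subst (λ w → gap G square v w ≡ 0ℤ) (sym (swapVal-not-pair v∉t)) (gap-refl G square v)

    module _ {y} (vy : IsVertex m n k y) (zero-gap : ZeroGap G square x y) where

      y-off : ∀ p → p ∉ Q → y p ≡ x p
      y-off p p∉Q = gap-diagonal≡0 (gap-withPair≡0-out (p∉Q ∘ pair⇒∈Q p) (zero-gap p))

      y-in : ∀ {p} → Pair t (x p) → Pair t (y p)
      y-in {p} xp∈t = gap-withPair≡0-in xp∈t (zero-gap p)

      determined : (∀ p → y p ≡ x p) ⊎ (∀ p → y p ≡ x′ p)
      determined with distinct-in-pair (y-in (inj₁ xi≡t)) (y-in (inj₂ xj≡t+1))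
                                       (injective⇒≢ (proj₂ (proj₁ vy)) xi≢xj)
      ... | inj₁ (yi≡t , yj≡t+1) =
        inj₁ (agree-outside Q y-off (λ _ _ → refl) (trans yi≡t (sym xi≡t) ∷ trans yj≡t+1 (sym xj≡t+1) ∷ []))
      ... | inj₂ (yi≡t+1 , yj≡t) =
        inj₂ (agree-outside Q y-off x′-off (trans yi≡t+1 (sym x′i≡t+1) ∷ trans yj≡t (sym x′j≡t) ∷ []))

  isEdge : IsEdge m n k x x′
  isEdge = isEdge-byGap {m} {n} {k} G square vx vx′ x≢x′
             (gap-withPair-nonneg gap-diagonal-nonneg) (zeroGap-relabel σ σ-tight x′≗) (λ y vy → determined vy)

n+2≰1+n : ∀ n → ¬ (n ℕ.+ 2 ≤ ℕ.suc n)
n+2≰1+n n = ℕₚ.1+n≰n ∘ subst (_≤ ℕ.suc n) (ℕₚ.+-comm n 2)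

pair-lower : ∀ {t v} → Pair t v → t ≤ v
pair-lower (inj₁ refl) = ℕₚ.≤-refl
pair-lower (inj₂ refl) = ℕₚ.n≤1+n _

pair-upper : ∀ {t v} → Pair t v → v ≤ ℕ.suc t
pair-upper (inj₁ refl) = ℕₚ.n≤1+n _
pair-upper (inj₂ refl) = ℕₚ.≤-refl

apart⇒disjoint : ∀ {t s v} → t ℕ.+ 2 ≤ s ⊎ s ℕ.+ 2 ≤ t → Pair t v → ¬ Pair s v
apart⇒disjoint {t} (inj₁ t+2≤s) v∈t v∈s =
  n+2≰1+n t (ℕₚ.≤-trans t+2≤s (ℕₚ.≤-trans (pair-lower v∈s) (pair-upper v∈t)))
apart⇒disjoint {s = s} (inj₂ s+2≤t) v∈t v∈s =
  n+2≰1+n s (ℕₚ.≤-trans s+2≤t (ℕₚ.≤-trans (pair-lower v∈t) (pair-upper v∈s)))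

module Move₂ {m n k} {x x′ : Fin (m ℕ.+ n) → ℕ} (vx : IsVertex m n k x) (vx′ : IsVertex m n k x′)
             {t s a b i j} (apart : t ℕ.+ 2 ≤ s ⊎ s ℕ.+ 2 ≤ t)
             (xa≡t+1 : x a ≡ ℕ.suc t) (a∈M : InM m a) (xb≡s : x b ≡ s) (b∈M : InM m b)
             (xi≡t : x i ≡ t) (i∉M : ¬ InM m i) (xj≡s+1 : x j ≡ ℕ.suc s) (j∉M : ¬ InM m j)
             (x′≗ : ∀ p → x′ p ≡ swapVal t (ℕ.suc t) (swapVal s (ℕ.suc s) (x p))) where

  private
    σ : ℕ → ℕ
    σ v = swapVal t (ℕ.suc t) (swapVal s (ℕ.suc s) v)

    G : ℕ → ℤ
    G = withPair t (withPair s diagonal)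

    x-inj : Injective _≡_ _≡_ x
    x-inj = proj₂ (proj₁ vx)

    t∉s : ∀ {v} → Pair t v → ¬ Pair s v
    t∉s = apart⇒disjoint apart

    s∉t : ∀ {v} → Pair s v → ¬ Pair t v
    s∉t = apart⇒disjoint (Sum.swap apart)

    σ-t : ∀ {v} → Pair t v → σ v ≡ swapVal t (ℕ.suc t) v
    σ-t v∈t = cong (swapVal t (ℕ.suc t)) (swapVal-not-pair (t∉s v∈t))

    σ-s : ∀ {v} → Pair s v → σ v ≡ swapVal s (ℕ.suc s) v
    σ-s v∈s = swapVal-not-pair (s∉t (swapVal-pair v∈s))

    σ-off : ∀ {v} → ¬ Pair t v → ¬ Pair s v → σ v ≡ v
    σ-off v∉t v∉s = trans (cong (swapVal t (ℕ.suc t)) (swapVal-not-pair v∉s)) (swapVal-not-pair v∉t)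

    σ-tight : ∀ v → gap G square v (σ v) ≡ 0ℤ
    σ-tight v with pair? t v | pair? s v
    ... | yes v∈t | _       = gap-withPair-within v∈t (subst (Pair t) (sym (σ-t v∈t)) (swapVal-pair v∈t))
    ... | no  v∉t | yes v∈s = trans (gap-withPair-out square (σ v) v∉t)
                                (gap-withPair-within v∈s (subst (Pair s) (sym (σ-s v∈s)) (swapVal-pair v∈s)))
    ... | no  v∉t | no  v∉s = subst (λ w → gap G square v w ≡ 0ℤ) (sym (σ-off v∉t v∉s)) (gap-refl G square v)

    Q : List (Fin (m ℕ.+ n))
    Q = a ∷ i ∷ b ∷ j ∷ []

    pair-t⇒∈Q : ∀ p → Pair t (x p) → p ∈ Q
    pair-t⇒∈Q p (inj₁ xp≡t)   = there (here (x-inj (trans xp≡t (sym xi≡t))))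
    pair-t⇒∈Q p (inj₂ xp≡t+1) = here (x-inj (trans xp≡t+1 (sym xa≡t+1)))

    pair-s⇒∈Q : ∀ p → Pair s (x p) → p ∈ Q
    pair-s⇒∈Q p (inj₁ xp≡s)   = there (there (here (x-inj (trans xp≡s (sym xb≡s)))))
    pair-s⇒∈Q p (inj₂ xp≡s+1) = there (there (there (here (x-inj (trans xp≡s+1 (sym xj≡s+1))))))

    x′a≡t : x′ a ≡ t
    x′a≡t rewrite x′≗ a | xa≡t+1 = trans (σ-t (inj₂ refl)) (swapVal-right t (ℕ.suc t))

    x′i≡t+1 : x′ i ≡ ℕ.suc t
    x′i≡t+1 rewrite x′≗ i | xi≡t = trans (σ-t (inj₁ refl)) (swapVal-left t (ℕ.suc t))

    x′b≡s+1 : x′ b ≡ ℕ.suc s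
    x′b≡s+1 rewrite x′≗ b | xb≡s = trans (σ-s (inj₁ refl)) (swapVal-left s (ℕ.suc s))

    x′j≡s : x′ j ≡ s
    x′j≡s rewrite x′≗ j | xj≡s+1 = trans (σ-s (inj₂ refl)) (swapVal-right s (ℕ.suc s))

    x′-off : ∀ p → p ∉ Q → x′ p ≡ x p
    x′-off p p∉Q = trans (x′≗ p) (σ-off (p∉Q ∘ pair-t⇒∈Q p) (p∉Q ∘ pair-s⇒∈Q p))

    x≢x′ : ¬ (∀ p → x p ≡ x′ p)
    x≢x′ x≗x′ = ℕₚ.1+n≢n (trans (sym x′i≡t+1) (trans (sym (x≗x′ i)) xi≡t))

    xi≢xa : x i ≢ x a
    xi≢xa xi≡xa = ℕₚ.1+n≢n (trans (sym xa≡t+1) (trans (sym xi≡xa) xi≡t))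

    xb≢xj : x b ≢ x j
    xb≢xj xb≡xj = ℕₚ.1+n≢n (trans (sym xj≡s+1) (trans (sym xb≡xj) xb≡s))

    a≢b : a ≢ b
    a≢b a≡b = s∉t (inj₁ xb≡s) (subst (λ q → Pair t (x q)) a≡b (inj₂ xa≡t+1))

    module _ {y} (vy : IsVertex m n k y) (zero-gap : ZeroGap G square x y) where

      y-inj : Injective _≡_ _≡_ y
      y-inj = proj₂ (proj₁ vy)

      y-off : ∀ p → p ∉ Q → y p ≡ x p
      y-off p p∉Q = gap-diagonal≡0 (gap-withPair≡0-out (p∉Q ∘ pair-s⇒∈Q p)
                      (gap-withPair≡0-out (p∉Q ∘ pair-t⇒∈Q p) (zero-gap p)))

      y-in-t : ∀ {p} → Pair t (x p) → Pair t (y p)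
      y-in-t {p} xp∈t = gap-withPair≡0-in xp∈t (zero-gap p)

      y-in-s : ∀ {p} → Pair s (x p) → Pair s (y p)
      y-in-s {p} xp∈s = gap-withPair≡0-in xp∈s (gap-withPair≡0-out (s∉t xp∈s) (zero-gap p))

      y-off-M : ∀ p → p ≢ a → p ≢ b → InM m p → y p ≡ x p
      y-off-M p p≢a p≢b p∈M = y-off p λ where
        (here p≡a)                         → p≢a p≡a
        (there (here p≡i))                 → i∉M (subst (InM m) p≡i p∈M)
        (there (there (here p≡b)))         → p≢b p≡b
        (there (there (there (here p≡j)))) → j∉M (subst (InM m) p≡j p∈M)

      ya+yb : y a ℕ.+ y b ≡ ℕ.suc t ℕ.+ s
      ya+yb = trans (firstSum-except₂ (trans (proj₂ vy) (sym (proj₂ vx))) a≢b a∈M b∈M y-off-M)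
                    (cong₂ ℕ._+_ xa≡t+1 xb≡s)

      determined : (∀ p → y p ≡ x p) ⊎ (∀ p → y p ≡ x′ p)
      determined with distinct-in-pair (y-in-t (inj₁ xi≡t)) (y-in-t (inj₂ xa≡t+1)) (injective⇒≢ y-inj xi≢xa)
                    | distinct-in-pair (y-in-s (inj₁ xb≡s)) (y-in-s (inj₂ xj≡s+1)) (injective⇒≢ y-inj xb≢xj)
      ... | inj₁ (yi≡t , ya≡t+1) | inj₁ (yb≡s , yj≡s+1) =
        inj₁ (agree-outside Q y-off (λ _ _ → refl)
               (trans ya≡t+1 (sym xa≡t+1) ∷ trans yi≡t (sym xi≡t) ∷
                trans yb≡s (sym xb≡s) ∷ trans yj≡s+1 (sym xj≡s+1) ∷ []))
      ... | inj₂ (yi≡t+1 , ya≡t) | inj₂ (yb≡s+1 , yj≡s) =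
        inj₂ (agree-outside Q y-off x′-off
               (trans ya≡t (sym x′a≡t) ∷ trans yi≡t+1 (sym x′i≡t+1) ∷
                trans yb≡s+1 (sym x′b≡s+1) ∷ trans yj≡s (sym x′j≡s) ∷ []))
      ... | inj₁ (_ , ya≡t+1) | inj₂ (yb≡s+1 , _) =
        contradiction (ℕₚ.+-cancelˡ-≡ (ℕ.suc t) _ _ (trans (sym (cong₂ ℕ._+_ ya≡t+1 yb≡s+1)) ya+yb)) ℕₚ.1+n≢n
      ... | inj₂ (_ , ya≡t) | inj₁ (yb≡s , _) =
        contradiction (ℕₚ.+-cancelʳ-≡ s _ _ (trans (sym (cong₂ ℕ._+_ ya≡t yb≡s)) ya+yb)) (ℕₚ.1+n≢n ∘ sym)

  isEdge : IsEdge m n k x x′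
  isEdge = isEdge-byGap {m} {n} {k} G square vx vx′ x≢x′
             (gap-withPair-nonneg (gap-withPair-nonneg gap-diagonal-nonneg)) (zeroGap-relabel σ σ-tight x′≗)
             (λ y vy → determined vy)

swapVal-triple : ∀ {t v} → Triple t v → Triple t (swapVal t (t ℕ.+ 2) v)
swapVal-triple {t} (inj₁ refl)        = inj₂ (inj₂ (swapVal-left t (t ℕ.+ 2)))
swapVal-triple {t} (inj₂ (inj₁ refl)) = inj₂ (inj₁ (swapVal-other (ℕₚ.1+n≢n) (t+2≢t+1 ∘ sym)))
swapVal-triple {t} (inj₂ (inj₂ refl)) = inj₁ (swapVal-right t (t ℕ.+ 2))

swapVal-not-triple : ∀ {t v} → ¬ Triple t v → swapVal t (t ℕ.+ 2) v ≡ v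
swapVal-not-triple v∉t = swapVal-other (v∉t ∘ inj₁) (v∉t ∘ inj₂ ∘ inj₂)

triple-ends : ∀ {t u} → Triple t u → u ≢ ℕ.suc t → u ≡ t ⊎ u ≡ t ℕ.+ 2
triple-ends (inj₁ u≡t)          _       = inj₁ u≡t
triple-ends (inj₂ (inj₁ u≡t+1)) u≢t+1   = contradiction u≡t+1 u≢t+1
triple-ends (inj₂ (inj₂ u≡t+2)) _       = inj₂ u≡t+2

triple-middle : ∀ {t w} → Triple t w → w ≢ t → w ≢ t ℕ.+ 2 → w ≡ ℕ.suc t
triple-middle (inj₁ w≡t)          w≢t _     = contradiction w≡t w≢t
triple-middle (inj₂ (inj₁ w≡t+1)) _   _     = w≡t+1
triple-middle (inj₂ (inj₂ w≡t+2)) _   w≢t+2 = contradiction w≡t+2 w≢t+2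

t+[t+2]≡[t+1]+[t+1] : ∀ t → t ℕ.+ (t ℕ.+ 2) ≡ ℕ.suc t ℕ.+ ℕ.suc t
t+[t+2]≡[t+1]+[t+1] t = trans (cong (t ℕ.+_) (ℕₚ.+-comm t 2)) (ℕₚ.+-suc t (ℕ.suc t))

Ends : ℕ → ℕ → ℕ → Set
Ends t u v = (u ≡ t × v ≡ t ℕ.+ 2) ⊎ (u ≡ t ℕ.+ 2 × v ≡ t)

ends-by-sum : ∀ {t u v} → Triple t u → Triple t v → u ≢ v → u ℕ.+ v ≡ t ℕ.+ (t ℕ.+ 2) → Ends t u v
ends-by-sum {t} {u} {v} u∈t v∈t u≢v u+v≡ =
  distinct-in-pair (triple-ends u∈t u≢t+1) (triple-ends v∈t v≢t+1) u≢v
  where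
  u+v≡[t+1]+[t+1] : u ℕ.+ v ≡ ℕ.suc t ℕ.+ ℕ.suc t
  u+v≡[t+1]+[t+1] = trans u+v≡ (t+[t+2]≡[t+1]+[t+1] t)
  u≢t+1 : u ≢ ℕ.suc t
  u≢t+1 refl = u≢v (sym (ℕₚ.+-cancelˡ-≡ u _ _ u+v≡[t+1]+[t+1]))
  v≢t+1 : v ≢ ℕ.suc t
  v≢t+1 refl = u≢v (ℕₚ.+-cancelʳ-≡ v _ _ u+v≡[t+1]+[t+1])

ends-by-middle : ∀ {t u v w} → Triple t u → Triple t v → u ≢ v → u ≢ w → v ≢ w → w ≡ ℕ.suc t → Ends t u v
ends-by-middle u∈t v∈t u≢v u≢w v≢w refl = distinct-in-pair (triple-ends u∈t u≢w) (triple-ends v∈t v≢w) u≢v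

middle-by-ends : ∀ {t u v w} → Triple t w → u ≢ w → v ≢ w → Ends t u v → w ≡ ℕ.suc t
middle-by-ends w∈t u≢w v≢w (inj₁ (refl , refl)) = triple-middle w∈t (u≢w ∘ sym) (v≢w ∘ sym)
middle-by-ends w∈t u≢w v≢w (inj₂ (refl , refl)) = triple-middle w∈t (v≢w ∘ sym) (u≢w ∘ sym)

module Move₃ {m n k} {x x′ : Fin (m ℕ.+ n) → ℕ} (vx : IsVertex m n k x) (vx′ : IsVertex m n k x′)
             {t i j l} (xi≡t : x i ≡ t) (xj≡t+2 : x j ≡ t ℕ.+ 2) (xl≡t+1 : x l ≡ ℕ.suc t)
             (sides : (InM m i × InM m j × ¬ InM m l) ⊎ (¬ InM m i × ¬ InM m j × InM m l))
             (x′≗ : ∀ p → x′ p ≡ swapVal t (t ℕ.+ 2) (x p)) where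

  private
    σ : ℕ → ℕ
    σ = swapVal t (t ℕ.+ 2)

    G H : ℕ → ℤ
    G = tripleSlope t
    H = triplePotential t

    x-inj : Injective _≡_ _≡_ x
    x-inj = proj₂ (proj₁ vx)

    σ-tight : ∀ v → gap G H v (σ v) ≡ 0ℤ
    σ-tight v = case triple? t v of λ where
      (yes v∈t) → gap-triple-within v∈t (swapVal-triple v∈t)
      (no  v∉t) → subst (λ w → gap G H v w ≡ 0ℤ) (sym (swapVal-not-triple v∉t)) (gap-refl G H v)

    Q : List (Fin (m ℕ.+ n))
    Q = i ∷ l ∷ j ∷ []

    triple⇒∈Q : ∀ p → Triple t (x p) → p ∈ Q
    triple⇒∈Q p (inj₁ xp≡t)          = here (x-inj (trans xp≡t (sym xi≡t)))
    triple⇒∈Q p (inj₂ (inj₁ xp≡t+1)) = there (here (x-inj (trans xp≡t+1 (sym xl≡t+1))))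
    triple⇒∈Q p (inj₂ (inj₂ xp≡t+2)) = there (there (here (x-inj (trans xp≡t+2 (sym xj≡t+2)))))

    x′i≡t+2 : x′ i ≡ t ℕ.+ 2
    x′i≡t+2 rewrite x′≗ i | xi≡t = swapVal-left t (t ℕ.+ 2)

    x′l≡t+1 : x′ l ≡ ℕ.suc t
    x′l≡t+1 rewrite x′≗ l | xl≡t+1 = swapVal-other ℕₚ.1+n≢n (t+2≢t+1 ∘ sym)

    x′j≡t : x′ j ≡ t
    x′j≡t rewrite x′≗ j | xj≡t+2 = swapVal-right t (t ℕ.+ 2)

    x′-off : ∀ p → p ∉ Q → x′ p ≡ x p
    x′-off p p∉Q = trans (x′≗ p) (swapVal-not-triple (p∉Q ∘ triple⇒∈Q p))

    x≢x′ : ¬ (∀ p → x p ≡ x′ p)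
    x≢x′ x≗x′ = t≢t+2 (trans (sym xi≡t) (trans (x≗x′ i) x′i≡t+2))

    xi≢xj : x i ≢ x j
    xi≢xj xi≡xj = t≢t+2 (trans (sym xi≡t) (trans xi≡xj xj≡t+2))

    xi≢xl : x i ≢ x l
    xi≢xl xi≡xl = ℕₚ.1+n≢n (trans (sym xl≡t+1) (trans (sym xi≡xl) xi≡t))

    xj≢xl : x j ≢ x l
    xj≢xl xj≡xl = t+2≢t+1 (trans (sym xj≡t+2) (trans xj≡xl xl≡t+1))

    module _ {y} (vy : IsVertex m n k y) (zero-gap : ZeroGap G H x y) where

      y-inj : Injective _≡_ _≡_ y
      y-inj = proj₂ (proj₁ vy)

      y-off : ∀ p → p ∉ Q → y p ≡ x p
      y-off p p∉Q = gap-triple≡0-out (p∉Q ∘ triple⇒∈Q p) (zero-gap p)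

      y-in : ∀ {p} → Triple t (x p) → Triple t (y p)
      y-in {p} xp∈t = gap-triple≡0-in xp∈t (zero-gap p)

      firstSum≡ : firstSum m n y ≡ firstSum m n x
      firstSum≡ = trans (proj₂ vy) (sym (proj₂ vx))

      yi∈t : Triple t (y i)
      yi∈t = y-in (inj₁ xi≡t)

      yl∈t : Triple t (y l)
      yl∈t = y-in (inj₂ (inj₁ xl≡t+1))

      yj∈t : Triple t (y j)
      yj∈t = y-in (inj₂ (inj₂ xj≡t+2))

      yi≢yj : y i ≢ y j
      yi≢yj = injective⇒≢ y-inj xi≢xj

      yi≢yl : y i ≢ y l
      yi≢yl = injective⇒≢ y-inj xi≢xl

      yj≢yl : y j ≢ y l
      yj≢yl = injective⇒≢ y-inj xj≢xl

      Settled : Set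
      Settled = y l ≡ ℕ.suc t × Ends t (y i) (y j)

      settled-ends∈M : InM m i × InM m j × ¬ InM m l → Settled
      settled-ends∈M (i∈M , j∈M , l∉M) = middle-by-ends yl∈t yi≢yl yj≢yl ends , ends
        where
        y-off-M : ∀ p → p ≢ i → p ≢ j → InM m p → y p ≡ x p
        y-off-M p p≢i p≢j p∈M = y-off p λ where
          (here p≡i)                 → p≢i p≡i
          (there (here p≡l))         → l∉M (subst (InM m) p≡l p∈M)
          (there (there (here p≡j))) → p≢j p≡j
        ends : Ends t (y i) (y j)
        ends = ends-by-sum yi∈t yj∈t yi≢yj
                 (trans (firstSum-except₂ firstSum≡ (yi≢yj ∘ cong y) i∈M j∈M y-off-M) (cong₂ ℕ._+_ xi≡t xj≡t+2))

      settled-middle∈M : ¬ InM m i × ¬ InM m j × InM m l → Settled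
      settled-middle∈M (i∉M , j∉M , l∈M) = yl≡t+1 , ends-by-middle yi∈t yj∈t yi≢yj yi≢yl yj≢yl yl≡t+1
        where
        y-off-M : ∀ p → p ≢ l → InM m p → y p ≡ x p
        y-off-M p p≢l p∈M = y-off p λ where
          (here p≡i)                 → i∉M (subst (InM m) p≡i p∈M)
          (there (here p≡l))         → p≢l p≡l
          (there (there (here p≡j))) → j∉M (subst (InM m) p≡j p∈M)
        yl≡t+1 : y l ≡ ℕ.suc t
        yl≡t+1 = trans (firstSum-except firstSum≡ l∈M y-off-M) xl≡t+1

      determined : (∀ p → y p ≡ x p) ⊎ (∀ p → y p ≡ x′ p)
      determined with Sum.[ settled-ends∈M , settled-middle∈M ]′ sides
      ... | yl≡t+1 , inj₁ (yi≡t , yj≡t+2) =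
        inj₁ (agree-outside Q y-off (λ _ _ → refl)
               (trans yi≡t (sym xi≡t) ∷ trans yl≡t+1 (sym xl≡t+1) ∷ trans yj≡t+2 (sym xj≡t+2) ∷ []))
      ... | yl≡t+1 , inj₂ (yi≡t+2 , yj≡t) =
        inj₂ (agree-outside Q y-off x′-off
               (trans yi≡t+2 (sym x′i≡t+2) ∷ trans yl≡t+1 (sym x′l≡t+1) ∷ trans yj≡t (sym x′j≡t) ∷ []))

  isEdge : IsEdge m n k x x′
  isEdge = isEdge-byGap {m} {n} {k} G H vx vx′ x≢x′ gap-triple-nonneg (zeroGap-relabel σ σ-tight x′≗)
             (λ y vy → determined vy)

lemma4p2 : (m n : ℕ) → 1 ≤ m → 1 ≤ n → (k : ℤ) → (x x' : Fin (m Data.Nat.+ n) → ℕ) →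
    IsVertex m n k x → IsVertex m n k x' →
    (Move1 m n x x' ⊎ Move2 m n x x' ⊎ Move3 m n x x') →
    IsEdge m n k x x'
lemma4p2 m n _ _ k x x′ vx vx′ (inj₁ (t , i , j , xi≡t , xj≡t+1 , _ , x′≗)) =
  Move₁.isEdge {m} {n} {k} vx vx′ xi≡t xj≡t+1 x′≗
lemma4p2 m n _ _ k x x′ vx vx′
  (inj₂ (inj₁ (t , s , a , b , i , j , apart , xa≡t+1 , a∈M , xb≡s , b∈M , xi≡t , i∉M , xj≡s+1 , j∉M , x′≗))) =
  Move₂.isEdge {m} {n} {k} vx vx′ apart xa≡t+1 a∈M xb≡s b∈M xi≡t i∉M xj≡s+1 j∉M x′≗
lemma4p2 m n _ _ k x x′ vx vx′ (inj₂ (inj₂ (t , i , j , l , xi≡t , xj≡t+2 , xl≡t+1 , sides , x′≗))) =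
  Move₃.isEdge {m} {n} {k} vx vx′ xi≡t xj≡t+2 xl≡t+1 sides x′≗
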